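{- If ($r=9$ or $r>10$) and $s\ge 10$, then $\mathrm{mob}(C_r\,\square\, C_s)\ge 5$.
   Context: $C_k$ is the cycle on $k$ vertices, $\square$ the Cartesian product (so $C_r\,\square\,C_s$ is a torus graph). A set $S\subseteq V(G)$ is a general position set if no three vertices of $S$ lie on a common shortest path. Robots are placed one per vertex of a general position set $S$; a move $u\to v$ along an edge $uv$ with $u\in S$ is legal if $v\notin S$ and $(S\setminus\{u\})\cup\{v\}$ is a general position set. $S$ is a mobile general position set if some sequence of legal moves starting from $S$ visits every vertex at least once; $\mathrm{mob}(G)$ is the maximum size of a mobile general position set. -}

module Defs where

open import Level using (0ℓ)
open import Data.Nat using (ℕ; zero; suc; _+_; _≤_; _≥_; _%_; NonZero)
open import Data.Fin using (Fin; toℕ)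
open import Data.Product using (_×_; Σ; ∃; ∃-syntax; _,_)
open import Data.Sum using (_⊎_)
open import Data.List using (List; []; _∷_; length; lookup; _[_]∷=_)
open import Data.List.Membership.Propositional using (_∈_; _∉_)
open import Data.List.Relation.Unary.Any using (Any)
open import Data.List.Relation.Unary.Unique.Propositional using (Unique)
open import Relation.Binary.PropositionalEquality using (_≡_; _≢_)
open import Relation.Nullary using (¬_)

record Graph : Set₁ where
  field
    V   : Set
    Adj : V → V → Set
open Graph public

-- Cycle C_k on vertices 0..k-1: i ~ j iff j = i+1 or i = j+1, plus the
-- wrap-around edge between k-1 and 0 (used for k ≥ 3).
CycAdj : (k : ℕ) → Fin k → Fin k → Set
CycAdj k i j = (toℕ j ≡ suc (toℕ i)) ⊎ (toℕ i ≡ suc (toℕ j))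
  ⊎ (suc (toℕ i) ≡ k × toℕ j ≡ 0) ⊎ (suc (toℕ j) ≡ k × toℕ i ≡ 0)

Cycle : ℕ → Graph
Cycle k = record { V = Fin k ; Adj = CycAdj k }

_□_ : Graph → Graph → Graph
G □ H = record
  { V   = V G × V H
  ; Adj = λ { (a , b) (a' , b') → (Adj G a a' × b ≡ b') ⊎ (a ≡ a' × Adj H b b') } }

module _ (G : Graph) where

  data Walk : V G → V G → ℕ → Set where
    here : ∀ {u} → Walk u u 0
    step : ∀ {u v w n} → Adj G u v → Walk v w n → Walk u w (suc n)

  verts : ∀ {u w n} → Walk u w n → List (V G)
  verts {u} here = u ∷ []
  verts {u} (step _ p) = u ∷ verts p

  Dist : V G → V G → ℕ → Set
  Dist u w n = Walk u w n × (∀ m → Walk u w m → n ≤ m)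

  OnShortestPath : V G → V G → V G → Set
  OnShortestPath u v w = ∃[ n ] Σ (Walk u w n) λ p → Dist u w n × v ∈ verts p

  GeneralPosition : List (V G) → Set
  GeneralPosition S = ∀ {u v w} → u ∈ S → v ∈ S → w ∈ S →
    u ≢ v → v ≢ w → u ≢ w → ¬ OnShortestPath u v w

  Legal : (S S' : List (V G)) → Set
  Legal S S' = ∃[ i ] ∃[ v ] (Adj G (lookup S i) v × v ∉ S ×
                 S' ≡ (S [ i ]∷= v) × GeneralPosition S')

  data Moves : List (V G) → List (List (V G)) → Set where
    done : ∀ {S} → Moves S []
    move : ∀ {S S' L} → Legal S S' → Moves S' L → Moves S (S' ∷ L)

  Mobile : List (V G) → Set
  Mobile S = Unique S × GeneralPosition S ×
    ∃[ L ] (Moves S L × (∀ x → Any (x ∈_) (S ∷ L)))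

  MobAtLeast : ℕ → Set
  MobAtLeast k = ∃[ S ] (Mobile S × length S ≥ k)

-- The distance of C_r □ C_s is the sum of the two cycle distances; it bounds the length of every
-- walk from below and is attained by one, so a vertex v on a shortest u–w path satisfies
-- d(u,v) + d(v,w) ≤ d(u,w), and a set whose distinct triples all satisfy the strict triangle
-- inequality is in general position.
-- Write r = r₀ + 2m and s = s₀ + 2m' with r₀ ∈ {9, 12} and s₀ ∈ {10, 11}, and start the robots at
-- (0,0), (r−3, s−3), (r−3, 1), (r−2, h_s), (h_r, h_s), where h_r = ⌊(r−4)/2⌋ and h_s = ⌊(s−4)/2⌋.
-- Every coordinate is affine in m or m' with slope at most 2, hence so is every distance between such
-- points once finitely many coefficientwise comparisons hold; those comparisons, for this configuration
-- and for all configurations reached by the moves, are decided once per (r₀, s₀), uniformly in m and m'.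
-- Moving the five robots one at a time one step to the right, in a suitable order, stays in general
-- position and translates the set by (1,0); similarly upwards. Translations are isometries, so rounds of
-- r such steps to the right followed by one step up carry the robot starting at (0,0) over every vertex.

{-# OPTIONS --safe #-}
module Submission where

open import Defs
open import Data.Nat using (ℕ; _>_; _≥_)
open import Data.Sum using (_⊎_)
open import Relation.Binary.PropositionalEquality using (_≡_)

open import Data.Nat
  using (zero; suc; _+_; _*_; _∸_; _≤_; _<_; _⊓_; ∣_-_∣; _%_; _/_; ⌊_/2⌋; z≤n; s≤s; _≤?_; _<?_; _≟_;
         NonZero)
open import Data.Nat.Properties
open import Data.Nat.DivMod
  using (_mod_; %-distribˡ-+; m%n%n≡m%n; m≤n⇒m%n≡m; m<n⇒m%n≡m; n%n≡0; [m+n]%n≡m%n; [m+kn]%n≡m%n; m%n<n;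
         m≡m%n+[m/n]*n)
open import Data.Nat.Tactic.RingSolver using (solve-∀)
open import Data.Fin using (Fin; toℕ; fromℕ<; cast)
open import Data.Fin.Properties using (toℕ<n; toℕ-injective; toℕ-fromℕ<)
open import Data.Product using (_×_; _,_; proj₁; proj₂; ∃₂; ∃-syntax; map₁; map₂)
import Data.Product.Properties as Product
open import Data.Sum using (inj₁; inj₂)
open import Data.Maybe using (Maybe; just; nothing; _>>=_; from-just)
open import Function using (id)
open import Data.List using (List; []; _∷_; _++_; map; length; lookup; _[_]∷=_)
open import Data.List.Properties using (length-map; map-∷=; map-∘; map-cong)
import Data.List.Properties as List
open import Data.List.Membership.Propositional using (_∈_; _∉_; lose)
open import Data.List.Membership.Propositional.Properties using (∈-++⁺ˡ; ∈-++⁺ʳ; ∈-map⁻; ∈-map⁺)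
open import Data.List.Relation.Unary.Any using (Any; here; there)
open import Data.List.Relation.Unary.All as All using (All; []; _∷_; all?)
open import Data.List.Relation.Unary.All.Properties using (¬Any⇒All¬)
open import Data.List.Relation.Unary.AllPairs using (AllPairs; []; _∷_; allPairs?)
open import Data.List.Relation.Unary.Unique.Propositional using (Unique)
open import Relation.Nullary using (Dec; yes; no; contradiction)
open import Relation.Nullary.Decidable using (_×-dec_; _⊎-dec_; dec⇒maybe)
open import Relation.Binary.Definitions using (DecidableEquality)
open import Relation.Binary.PropositionalEquality
  using (_≢_; refl; sym; trans; cong; cong₂; subst; subst₂; module ≡-Reasoning)

module _ {G : Graph} where

  _++ʷ_ : ∀ {u v w m n} → Walk G u v m → Walk G v w n → Walk G u w (m + n)
  here     ++ʷ q = q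
  step e p ++ʷ q = step e (p ++ʷ q)

  splitWalk : ∀ {u v w n} (p : Walk G u w n) → v ∈ verts G p →
              ∃₂ λ m k → Walk G u v m × Walk G v w k × m + k ≡ n
  splitWalk here       (here refl) = 0 , 0 , here , here , refl
  splitWalk (step e p) (here refl) = 0 , _ , here , step e p , refl
  splitWalk (step e p) (there v∈p) with splitWalk p v∈p
  ... | m , k , p₁ , p₂ , refl = suc m , k , step e p₁ , p₂ , refl

  reverseWalk : (∀ {x y} → Adj G x y → Adj G y x) → ∀ {u w n} → Walk G u w n → Walk G w u n
  reverseWalk adj-sym here = here
  reverseWalk adj-sym (step {n = n} e p) =
    subst (Walk G _ _) (+-comm n 1) (reverseWalk adj-sym p ++ʷ step (adj-sym e) here)

  shorterWalk : ∀ {u w m n} → Walk G u w m → Walk G u w n → Walk G u w (m ⊓ n)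
  shorterWalk {m = m} {n} p q with ⊓-sel m n
  ... | inj₁ m⊓n≡m = subst (Walk G _ _) (sym m⊓n≡m) p
  ... | inj₂ m⊓n≡n = subst (Walk G _ _) (sym m⊓n≡n) q

mapWalk : ∀ {G H : Graph} (f : V G → V H) → (∀ {x y} → Adj G x y → Adj H (f x) (f y)) →
          ∀ {u w n} → Walk G u w n → Walk H (f u) (f w) n
mapWalk f f-adj here       = here
mapWalk f f-adj (step e p) = step (f-adj e) (mapWalk f f-adj p)

record WalkMetric (G : Graph) : Set where
  field
    dist      : V G → V G → ℕ
    dist-refl : ∀ u → dist u u ≡ 0
    dist-step : ∀ {u v} w → Adj G u v → dist u w ≤ suc (dist v w)
    geodesic  : ∀ u w → Walk G u w (dist u w)

  dist≤length : ∀ {u w n} → Walk G u w n → dist u w ≤ n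
  dist≤length {u} here         = ≤-reflexive (dist-refl u)
  dist≤length {w = w} (step e p) = ≤-trans (dist-step w e) (s≤s (dist≤length p))

  onShortestPath⇒dist-additive : ∀ {u v w} → OnShortestPath G u v w → dist u v + dist v w ≤ dist u w
  onShortestPath⇒dist-additive {u} {w = w} (_ , p , (_ , minimal) , v∈p) with splitWalk p v∈p
  ... | _ , _ , p₁ , p₂ , refl =
    ≤-trans (+-mono-≤ (dist≤length p₁) (dist≤length p₂)) (minimal (dist u w) (geodesic u w))

  StrictTriangles : List (V G) → Set
  StrictTriangles X = ∀ {u v w} → u ∈ X → v ∈ X → w ∈ X →
    u ≢ v → v ≢ w → u ≢ w → dist u w < dist u v + dist v w

  map-strictTriangles : ∀ {A : Set} (f : A → V G) {X : List A} →
    (∀ {x y z} → x ∈ X → y ∈ X → z ∈ X → f x ≢ f y → f y ≢ f z → f x ≢ f z →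
                 dist (f x) (f z) < dist (f x) (f y) + dist (f y) (f z)) →
    StrictTriangles (map f X)
  map-strictTriangles f strict u∈ v∈ w∈ with ∈-map⁻ f u∈ | ∈-map⁻ f v∈ | ∈-map⁻ f w∈
  ... | x , x∈ , refl | y , y∈ , refl | z , z∈ , refl = strict x∈ y∈ z∈

  strictTriangles⇒generalPosition : ∀ {X} → StrictTriangles X → GeneralPosition G X
  strictTriangles⇒generalPosition strict u∈X v∈X w∈X u≢v v≢w u≢w onPath =
    <⇒≱ (strict u∈X v∈X w∈X u≢v v≢w u≢w) (onShortestPath⇒dist-additive onPath)

  dist>0⇒≢ : ∀ {u v} → 0 < dist u v → u ≢ v
  dist>0⇒≢ {u} 0<d refl = <⇒≢ 0<d (sym (dist-refl u))

_□ᵐ_ : ∀ {G H} → WalkMetric G → WalkMetric H → WalkMetric (G □ H)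
_□ᵐ_ {G} {H} M N = record
  { dist      = dist
  ; dist-refl = dist-refl
  ; dist-step = dist-step
  ; geodesic  = geodesic
  }
  where
  module M = WalkMetric M
  module N = WalkMetric N

  dist : V (G □ H) → V (G □ H) → ℕ
  dist (a , b) (a' , b') = M.dist a a' + N.dist b b'

  dist-refl : ∀ u → dist u u ≡ 0
  dist-refl (a , b) rewrite M.dist-refl a | N.dist-refl b = refl

  dist-step : ∀ {u v} w → Adj (G □ H) u v → dist u w ≤ suc (dist v w)
  dist-step {a , b} (c , d) (inj₁ (e , refl)) = +-monoˡ-≤ (N.dist b d) (M.dist-step c e)
  dist-step {a , b} {a , b'} (c , d) (inj₂ (refl , e)) =
    ≤-trans (+-monoʳ-≤ (M.dist a c) (N.dist-step d e)) (≤-reflexive (+-suc _ _))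

  geodesic : ∀ u w → Walk (G □ H) u w (dist u w)
  geodesic (a , b) (a' , b') =
    mapWalk (_, b) (λ e → inj₁ (e , refl)) (M.geodesic a a') ++ʷ
    mapWalk (a' ,_) (λ e → inj₂ (refl , e)) (N.geodesic b b')

cycleDist : ℕ → ℕ → ℕ → ℕ
cycleDist k x y = ∣ x - y ∣ ⊓ (k ∸ ∣ x - y ∣)

cycleDist-refl : ∀ k x → cycleDist k x x ≡ 0
cycleDist-refl k x rewrite ∣n-n∣≡0 x = refl

cycleDist-comm : ∀ k x y → cycleDist k x y ≡ cycleDist k y x
cycleDist-comm k x y rewrite ∣-∣-comm x y = refl

n≤1+m⇒o∸m≤1+[o∸n] : ∀ o {m n} → n ≤ suc m → o ∸ m ≤ suc (o ∸ n)
n≤1+m⇒o∸m≤1+[o∸n] o {m} {n} n≤1+m = m≤n+o⇒m∸n≤o o m (begin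
  o                 ≤⟨ m≤n+m∸n o n ⟩
  n + (o ∸ n)       ≤⟨ +-monoˡ-≤ (o ∸ n) n≤1+m ⟩
  suc m + (o ∸ n)   ≡⟨ +-suc m (o ∸ n) ⟨
  m + suc (o ∸ n)   ∎)
  where open ≤-Reasoning

cycleDist-lipschitz : ∀ k x y z → ∣ x - y ∣ ≤ 1 → cycleDist k x z ≤ suc (cycleDist k y z)
cycleDist-lipschitz k x y z ∣x-y∣≤1 = ⊓-mono-≤ ∣x-z∣≤1+∣y-z∣ (n≤1+m⇒o∸m≤1+[o∸n] k ∣y-z∣≤1+∣x-z∣)
  where
  ∣x-z∣≤1+∣y-z∣ : ∣ x - z ∣ ≤ suc ∣ y - z ∣
  ∣x-z∣≤1+∣y-z∣ = ≤-trans (∣-∣-triangle x y z) (+-monoˡ-≤ ∣ y - z ∣ ∣x-y∣≤1)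
  ∣y-z∣≤1+∣x-z∣ : ∣ y - z ∣ ≤ suc ∣ x - z ∣
  ∣y-z∣≤1+∣x-z∣ =
    ≤-trans (∣-∣-triangle y x z) (+-monoˡ-≤ ∣ x - z ∣ (subst (_≤ 1) (∣-∣-comm x y) ∣x-y∣≤1))

∣n-1+n∣≡1 : ∀ n → ∣ n - suc n ∣ ≡ 1
∣n-1+n∣≡1 zero    = refl
∣n-1+n∣≡1 (suc n) = ∣n-1+n∣≡1 n

∣1+n-n∣≡1 : ∀ n → ∣ suc n - n ∣ ≡ 1
∣1+n-n∣≡1 n = trans (∣-∣-comm (suc n) n) (∣n-1+n∣≡1 n)

cycleDist-last : ∀ {n y} → y ≤ n → cycleDist (suc n) n y ≡ (n ∸ y) ⊓ suc y
cycleDist-last {n} {y} y≤n rewrite m≤n⇒∣n-m∣≡n∸m y≤n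
  | +-∸-assoc 1 (m∸n≤m n y) | m∸[m∸n]≡n y≤n = refl

cycleDist-first : ∀ {n y} → y ≤ n → cycleDist (suc n) 0 y ≡ y ⊓ suc (n ∸ y)
cycleDist-first {n} {y} y≤n rewrite +-∸-assoc 1 y≤n = refl

m⊓[1+n]≤1+[n⊓[1+m]] : ∀ m n → m ⊓ suc n ≤ suc (n ⊓ suc m)
m⊓[1+n]≤1+[n⊓[1+m]] m n =
  ⊓-glb (m⊓n≤n m (suc n)) (≤-trans (m⊓n≤m m (suc n)) (≤-trans (n≤1+n m) (n≤1+n (suc m))))

cycleDist-last≤first : ∀ {n y} → y ≤ n → cycleDist (suc n) n y ≤ suc (cycleDist (suc n) 0 y)
cycleDist-last≤first {n} {y} y≤n rewrite cycleDist-last y≤n | cycleDist-first y≤n =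
  m⊓[1+n]≤1+[n⊓[1+m]] (n ∸ y) y

cycleDist-first≤last : ∀ {n y} → y ≤ n → cycleDist (suc n) 0 y ≤ suc (cycleDist (suc n) n y)
cycleDist-first≤last {n} {y} y≤n rewrite cycleDist-last y≤n | cycleDist-first y≤n =
  m⊓[1+n]≤1+[n⊓[1+m]] y (n ∸ y)

[m%d+o]%d≡[m+o]%d : ∀ m o d → .{{_ : NonZero d}} → (m % d + o) % d ≡ (m + o) % d
[m%d+o]%d≡[m+o]%d m o d = begin
  (m % d + o) % d            ≡⟨ %-distribˡ-+ (m % d) o d ⟩
  (m % d % d + o % d) % d    ≡⟨ cong (λ r → (r + o % d) % d) (m%n%n≡m%n m d) ⟩
  (m % d + o % d) % d        ≡⟨ %-distribˡ-+ m o d ⟨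
  (m + o) % d                ∎
  where open ≡-Reasoning

[1+m%d]%d≡[1+m]%d : ∀ m d → .{{_ : NonZero d}} → suc (m % d) % d ≡ suc m % d
[1+m%d]%d≡[1+m]%d m d = begin
  suc (m % d) % d   ≡⟨ cong (_% d) (+-comm 1 (m % d)) ⟩
  (m % d + 1) % d   ≡⟨ [m%d+o]%d≡[m+o]%d m 1 d ⟩
  (m + 1) % d       ≡⟨ cong (_% d) (+-comm m 1) ⟩
  suc m % d         ∎
  where open ≡-Reasoning

suc%-cases : ∀ {n x} → x ≤ n → (x < n × suc x % suc n ≡ suc x) ⊎ (x ≡ n × suc x % suc n ≡ 0)
suc%-cases {n} x≤n with m≤n⇒m<n∨m≡n x≤n
... | inj₁ x<n  = inj₁ (x<n , m≤n⇒m%n≡m x<n)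
... | inj₂ refl = inj₂ (refl , n%n≡0 (suc n))

cycleDist-0-suc : ∀ {n y} → y ≤ n → cycleDist (suc n) 0 (suc y) ≡ cycleDist (suc n) n y
cycleDist-0-suc {n} {y} y≤n = trans (⊓-comm (suc y) (n ∸ y)) (sym (cycleDist-last y≤n))

cycleDist-suc% : ∀ {n x y} → x ≤ n → y ≤ n →
  cycleDist (suc n) (suc x % suc n) (suc y % suc n) ≡ cycleDist (suc n) x y
cycleDist-suc% {n} {x} {y} x≤n y≤n with suc%-cases x≤n | suc%-cases y≤n
... | inj₁ (_ , ex) | inj₁ (_ , ey) rewrite ex | ey = refl
... | inj₂ (refl , ex) | inj₂ (refl , ey) rewrite ex | ey = sym (cycleDist-refl (suc n) n)
... | inj₂ (refl , ex) | inj₁ (_ , ey) rewrite ex | ey = cycleDist-0-suc y≤n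
... | inj₁ (_ , ex) | inj₂ (refl , ey) rewrite ex | ey =
  trans (cycleDist-comm (suc n) (suc x) 0) (trans (cycleDist-0-suc x≤n) (cycleDist-comm (suc n) n x))

cycleDist-+% : ∀ {n x y} a → x ≤ n → y ≤ n →
  cycleDist (suc n) ((x + a) % suc n) ((y + a) % suc n) ≡ cycleDist (suc n) x y
cycleDist-+% {n} {x} {y} zero x≤n y≤n
  rewrite +-identityʳ x | +-identityʳ y | m≤n⇒m%n≡m x≤n | m≤n⇒m%n≡m y≤n = refl
cycleDist-+% {n} {x} {y} (suc a) x≤n y≤n
  rewrite +-suc x a | +-suc y a
        | sym ([1+m%d]%d≡[1+m]%d (x + a) (suc n)) | sym ([1+m%d]%d≡[1+m]%d (y + a) (suc n)) =
  trans (cycleDist-suc% (≤-pred (m%n<n (x + a) (suc n))) (≤-pred (m%n<n (y + a) (suc n))))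
        (cycleDist-+% a x≤n y≤n)

CycAdj-sym : ∀ {k} {x y : Fin k} → CycAdj k x y → CycAdj k y x
CycAdj-sym (inj₁ e)               = inj₂ (inj₁ e)
CycAdj-sym (inj₂ (inj₁ e))        = inj₁ e
CycAdj-sym (inj₂ (inj₂ (inj₁ e))) = inj₂ (inj₂ (inj₂ e))
CycAdj-sym (inj₂ (inj₂ (inj₂ e))) = inj₂ (inj₂ (inj₁ e))

module _ {n : ℕ} where

  toℕ-mod : ∀ m → toℕ (m mod suc n) ≡ m % suc n
  toℕ-mod m = toℕ-fromℕ< (m%n<n m (suc n))

  toℕ-% : ∀ (x : Fin (suc n)) → toℕ x % suc n ≡ toℕ x
  toℕ-% x = m<n⇒m%n≡m (toℕ<n x)

  [x+kn]mod≡x : ∀ (x : Fin (suc n)) k → (toℕ x + k * suc n) mod suc n ≡ x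
  [x+kn]mod≡x x k = toℕ-injective (begin
    toℕ ((toℕ x + k * suc n) mod suc n) ≡⟨ toℕ-mod (toℕ x + k * suc n) ⟩
    (toℕ x + k * suc n) % suc n        ≡⟨ [m+kn]%n≡m%n (toℕ x) k (suc n) ⟩
    toℕ x % suc n                      ≡⟨ toℕ-% x ⟩
    toℕ x                              ∎)
    where open ≡-Reasoning

  rotate : Fin (suc n) → Fin (suc n)
  rotate x = suc (toℕ x) mod suc n

  rotate-adj : ∀ x → CycAdj (suc n) x (rotate x)
  rotate-adj x with suc%-cases (≤-pred (toℕ<n x))
  ... | inj₁ (_ , e)     = inj₁ (trans (toℕ-mod (suc (toℕ x))) e)
  ... | inj₂ (x≡n , e) = inj₂ (inj₂ (inj₁ (cong suc x≡n , trans (toℕ-mod (suc (toℕ x))) e)))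

  mod-suc-adj : ∀ m → CycAdj (suc n) (m mod suc n) (suc m mod suc n)
  mod-suc-adj m = subst (CycAdj (suc n) (m mod suc n)) rotate-mod (rotate-adj (m mod suc n))
    where
    rotate-mod : rotate (m mod suc n) ≡ suc m mod suc n
    rotate-mod = toℕ-injective (begin
      toℕ (rotate (m mod suc n))            ≡⟨ toℕ-mod (suc (toℕ (m mod suc n))) ⟩
      suc (toℕ (m mod suc n)) % suc n        ≡⟨ cong (λ r → suc r % suc n) (toℕ-mod m) ⟩
      suc (m % suc n) % suc n                ≡⟨ [1+m%d]%d≡[1+m]%d m (suc n) ⟩
      suc m % suc n                          ≡⟨ toℕ-mod (suc m) ⟨
      toℕ (suc m mod suc n)                  ∎)
      where open ≡-Reasoning

  rotationWalk : ∀ d x y → (toℕ x + d) % suc n ≡ toℕ y → Walk (Cycle (suc n)) x y d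
  rotationWalk zero x y eq = subst (λ y → Walk (Cycle (suc n)) x y 0) (toℕ-injective x≡y) here
    where
    x≡y : toℕ x ≡ toℕ y
    x≡y = trans (sym (toℕ-% x)) (trans (cong (_% suc n) (sym (+-identityʳ (toℕ x)))) eq)
  rotationWalk (suc d) x y eq = step (rotate-adj x) (rotationWalk d (rotate x) y (begin
    (toℕ (rotate x) + d) % suc n          ≡⟨ cong (λ r → (r + d) % suc n) (toℕ-mod (suc (toℕ x))) ⟩
    (suc (toℕ x) % suc n + d) % suc n     ≡⟨ [m%d+o]%d≡[m+o]%d (suc (toℕ x)) d (suc n) ⟩
    (suc (toℕ x) + d) % suc n             ≡⟨ cong (_% suc n) (+-suc (toℕ x) d) ⟨
    (toℕ x + suc d) % suc n               ≡⟨ eq ⟩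
    toℕ y                                 ∎))
    where open ≡-Reasoning

  cycleGeodesic-≤ : ∀ x y → toℕ x ≤ toℕ y → Walk (Cycle (suc n)) x y (cycleDist (suc n) (toℕ x) (toℕ y))
  cycleGeodesic-≤ x y x≤y rewrite m≤n⇒∣m-n∣≡n∸m x≤y =
    shorterWalk (rotationWalk d x y forward) (reverseWalk CycAdj-sym (rotationWalk (suc n ∸ d) y x backward))
    where
    open ≡-Reasoning
    d = toℕ y ∸ toℕ x
    d≤1+n : d ≤ suc n
    d≤1+n = ≤-trans (m∸n≤m (toℕ y) (toℕ x)) (<⇒≤ (toℕ<n y))
    forward : (toℕ x + d) % suc n ≡ toℕ y
    forward rewrite m+[n∸m]≡n x≤y = toℕ-% y
    backward : (toℕ y + (suc n ∸ d)) % suc n ≡ toℕ x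
    backward = begin
      (toℕ y + (suc n ∸ d)) % suc n        ≡⟨ cong (λ r → (r + (suc n ∸ d)) % suc n) (m+[n∸m]≡n x≤y) ⟨
      (toℕ x + d + (suc n ∸ d)) % suc n    ≡⟨ cong (_% suc n) (+-assoc (toℕ x) d (suc n ∸ d)) ⟩
      (toℕ x + (d + (suc n ∸ d))) % suc n  ≡⟨ cong (λ r → (toℕ x + r) % suc n) (m+[n∸m]≡n d≤1+n) ⟩
      (toℕ x + suc n) % suc n              ≡⟨ [m+n]%n≡m%n (toℕ x) (suc n) ⟩
      toℕ x % suc n                        ≡⟨ toℕ-% x ⟩
      toℕ x                                ∎

cycleMetric : ∀ n → WalkMetric (Cycle (suc n))
cycleMetric n = record
  { dist      = dist
  ; dist-refl = λ x → cycleDist-refl (suc n) (toℕ x)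
  ; dist-step = dist-step
  ; geodesic  = geodesic
  }
  where
  dist : Fin (suc n) → Fin (suc n) → ℕ
  dist x y = cycleDist (suc n) (toℕ x) (toℕ y)

  dist-step : ∀ {x y} z → CycAdj (suc n) x y → dist x z ≤ suc (dist y z)
  dist-step {x} {y} z (inj₁ e) rewrite e =
    cycleDist-lipschitz (suc n) (toℕ x) (suc (toℕ x)) (toℕ z) (≤-reflexive (∣n-1+n∣≡1 (toℕ x)))
  dist-step {x} {y} z (inj₂ (inj₁ e)) rewrite e =
    cycleDist-lipschitz (suc n) (suc (toℕ y)) (toℕ y) (toℕ z) (≤-reflexive (∣1+n-n∣≡1 (toℕ y)))
  dist-step {x} {y} z (inj₂ (inj₂ (inj₁ (1+x≡1+n , y≡0)))) rewrite suc-injective 1+x≡1+n | y≡0 =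
    cycleDist-last≤first (≤-pred (toℕ<n z))
  dist-step {x} {y} z (inj₂ (inj₂ (inj₂ (1+y≡1+n , x≡0)))) rewrite suc-injective 1+y≡1+n | x≡0 =
    cycleDist-first≤last (≤-pred (toℕ<n z))

  geodesic : ∀ x y → Walk (Cycle (suc n)) x y (dist x y)
  geodesic x y with toℕ x ≤? toℕ y
  ... | yes x≤y = cycleGeodesic-≤ x y x≤y
  ... | no  x≰y = subst (Walk (Cycle (suc n)) x y) (cycleDist-comm (suc n) (toℕ y) (toℕ x))
                        (reverseWalk CycAdj-sym (cycleGeodesic-≤ y x (<⇒≤ (≰⇒> x≰y))))

module _ {G : Graph} where

  Block : List (V G) → List (V G) → Set
  Block S S' = ∃[ Ls ] (S' ∈ S ∷ Ls × (∀ {L} → Moves G S' L → Moves G S (Ls ++ L)))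

  block-visits : ∀ {S S'} (B : Block S S') {L c} → c ∈ S' ∷ L → c ∈ S ∷ proj₁ B ++ L
  block-visits (Ls , S'∈ , _) (here refl)  = ∈-++⁺ˡ S'∈
  block-visits (Ls , S'∈ , _) (there c∈L) = there (∈-++⁺ʳ Ls c∈L)

  module GridTour (C : ℕ → ℕ → List (V G))
                  (right : ∀ a b → Block (C a b) (C (suc a) b))
                  (up    : ∀ a b → Block (C a b) (C a (suc b)))
                  (R : ℕ) where

    tour : ℕ → ℕ → ℕ → ℕ → List (List (V G))
    tour a b (suc i) j       = proj₁ (right a b) ++ tour (suc a) b i j
    tour a b zero    (suc j) = proj₁ (up a b) ++ tour a (suc b) R j
    tour a b zero    zero    = []

    tour-moves : ∀ a b i j → Moves G (C a b) (tour a b i j)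
    tour-moves a b (suc i) j       = proj₂ (proj₂ (right a b)) (tour-moves (suc a) b i j)
    tour-moves a b zero    (suc j) = proj₂ (proj₂ (up a b)) (tour-moves a (suc b) R j)
    tour-moves a b zero    zero    = done

    Visited : ℕ → ℕ → ℕ → ℕ → List (V G) → Set
    Visited a b i j c = c ∈ C a b ∷ tour a b i j

    visits-row : ∀ k a b i j → k ≤ i → Visited a b i j (C (k + a) b)
    visits-row zero    a b i       j _         = here refl
    visits-row (suc k) a b (suc i) j (s≤s k≤i) =
      block-visits (right a b)
        (subst (λ x → Visited (suc a) b i j (C x b)) (+-suc k a) (visits-row k (suc a) b i j k≤i))

    visits-after-row : ∀ i a b j {c} → Visited (i + a) b zero j c → Visited a b i j c
    visits-after-row zero    a b j c∈ = c∈
    visits-after-row (suc i) a b j {c} c∈ =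
      block-visits (right a b)
        (visits-after-row i (suc a) b j (subst (λ x → Visited x b zero j c) (sym (+-suc i a)) c∈))

    visits-grid : ∀ k l a b J → k ≤ R → l ≤ J → Visited a b R J (C (k + (l * R + a)) (l + b))
    visits-grid k zero    a b J       k≤R _         = visits-row k a b R J k≤R
    visits-grid k (suc l) a b (suc J) k≤R (s≤s l≤J) =
      visits-after-row R a b (suc J) (block-visits (up (R + a) b)
        (subst (Visited (R + a) (suc b) R J) (cong₂ (λ x y → C (k + x) y) shift (+-suc l b))
          (visits-grid k l (R + a) (suc b) J k≤R l≤J)))
      where
      shift : l * R + (R + a) ≡ suc l * R + a
      shift = trans (sym (+-assoc (l * R) R a)) (cong (_+ a) (+-comm (l * R) R))

    tour-visits : ∀ k l J → k ≤ R → l ≤ J → C (k + l * R) l ∈ C 0 0 ∷ tour 0 0 R J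
    tour-visits k l J k≤R l≤J =
      subst (Visited 0 0 R J) (cong₂ (λ x y → C (k + x) y) (+-identityʳ (l * R)) (+-identityʳ l))
        (visits-grid k l 0 0 J k≤R l≤J)

Affine : Set
Affine = ℕ × ℕ

⟦_⟧ : Affine → ℕ → ℕ
⟦ c , e ⟧ m = c + e * m

_≤ᵃ_ : Affine → Affine → Set
(c , e) ≤ᵃ (c' , e') = c ≤ c' × e ≤ e'

_≤ᵃ?_ : ∀ x y → Dec (x ≤ᵃ y)
(c , e) ≤ᵃ? (c' , e') = (c ≤? c') ×-dec (e ≤? e')

Comparable : Affine → Affine → Set
Comparable x y = x ≤ᵃ y ⊎ y ≤ᵃ x

comparable? : ∀ x y → Dec (Comparable x y)
comparable? x y = (x ≤ᵃ? y) ⊎-dec (y ≤ᵃ? x)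

_-ᵃ_ : Affine → Affine → Affine
(c , e) -ᵃ (c' , e') = c ∸ c' , e ∸ e'

_⊓ᵃ_ : Affine → Affine → Affine
x ⊓ᵃ y with x ≤ᵃ? y
... | yes _ = x
... | no  _ = y

∣_-ᵃ_∣ : Affine → Affine → Affine
∣ x -ᵃ y ∣ with x ≤ᵃ? y
... | yes _ = y -ᵃ x
... | no  _ = x -ᵃ y

⟦⟧-mono : ∀ {x y} m → x ≤ᵃ y → ⟦ x ⟧ m ≤ ⟦ y ⟧ m
⟦⟧-mono m (c≤c' , e≤e') = +-mono-≤ c≤c' (*-monoˡ-≤ m e≤e')

⟦-ᵃ⟧ : ∀ {x y} m → y ≤ᵃ x → ⟦ x -ᵃ y ⟧ m ≡ ⟦ x ⟧ m ∸ ⟦ y ⟧ m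
⟦-ᵃ⟧ {c , e} {c' , e'} m (c'≤c , e'≤e) = sym (begin
  (c + e * m) ∸ (c' + e' * m)
    ≡⟨ cong₂ (λ a b → (a + b * m) ∸ (c' + e' * m)) (m+[n∸m]≡n c'≤c) (m+[n∸m]≡n e'≤e) ⟨
  (c' + (c ∸ c')) + (e' + (e ∸ e')) * m ∸ (c' + e' * m)
    ≡⟨ cong (_∸ (c' + e' * m)) (regroup c' (c ∸ c') e' (e ∸ e') m) ⟩
  (c' + e' * m) + ((c ∸ c') + (e ∸ e') * m) ∸ (c' + e' * m)
    ≡⟨ m+n∸m≡n (c' + e' * m) _ ⟩
  (c ∸ c') + (e ∸ e') * m ∎)
  where
  open ≡-Reasoning
  regroup : ∀ a b c d m → (a + b) + (c + d) * m ≡ (a + c * m) + (b + d * m)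
  regroup = solve-∀

⟦⊓ᵃ⟧ : ∀ {x y} m → Comparable x y → ⟦ x ⊓ᵃ y ⟧ m ≡ ⟦ x ⟧ m ⊓ ⟦ y ⟧ m
⟦⊓ᵃ⟧ {x} {y} m x~y with x ≤ᵃ? y | x~y
... | yes x≤y | _       = sym (m≤n⇒m⊓n≡m (⟦⟧-mono m x≤y))
... | no  x≰y | inj₁ x≤y = contradiction x≤y x≰y
... | no  _   | inj₂ y≤x = sym (m≥n⇒m⊓n≡n (⟦⟧-mono m y≤x))

⟦∣-ᵃ∣⟧ : ∀ {x y} m → Comparable x y → ⟦ ∣ x -ᵃ y ∣ ⟧ m ≡ ∣ ⟦ x ⟧ m - ⟦ y ⟧ m ∣
⟦∣-ᵃ∣⟧ {x} {y} m x~y with x ≤ᵃ? y | x~y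
... | yes x≤y | _       = trans (⟦-ᵃ⟧ m x≤y) (sym (m≤n⇒∣m-n∣≡n∸m (⟦⟧-mono m x≤y)))
... | no  x≰y | inj₁ x≤y = contradiction x≤y x≰y
... | no  _   | inj₂ y≤x = trans (⟦-ᵃ⟧ m y≤x) (sym (m≤n⇒∣n-m∣≡n∸m (⟦⟧-mono m y≤x)))

cycleLengthᵃ : ℕ → Affine
cycleLengthᵃ k = suc k , 2

cycleDistᵃ : ℕ → Affine → Affine → Affine
cycleDistᵃ k x y = ∣ x -ᵃ y ∣ ⊓ᵃ (cycleLengthᵃ k -ᵃ ∣ x -ᵃ y ∣)

CycleDistExact : ℕ → Affine → Affine → Set
CycleDistExact k x y =
  Comparable x y × ∣ x -ᵃ y ∣ ≤ᵃ cycleLengthᵃ k × Comparable ∣ x -ᵃ y ∣ (cycleLengthᵃ k -ᵃ ∣ x -ᵃ y ∣)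

cycleDistExact? : ∀ k x y → Dec (CycleDistExact k x y)
cycleDistExact? k x y =
  comparable? x y ×-dec (∣ x -ᵃ y ∣ ≤ᵃ? cycleLengthᵃ k) ×-dec comparable? _ _

⟦cycleDistᵃ⟧ : ∀ k {x y} m → CycleDistExact k x y →
  ⟦ cycleDistᵃ k x y ⟧ m ≡ cycleDist (suc k + 2 * m) (⟦ x ⟧ m) (⟦ y ⟧ m)
⟦cycleDistᵃ⟧ k m (x~y , δ≤r , δ~r-δ) rewrite ⟦⊓ᵃ⟧ m δ~r-δ | ⟦-ᵃ⟧ m δ≤r | ⟦∣-ᵃ∣⟧ m x~y = refl

Bounded : ℕ → Affine → Set
Bounded k (c , e) = c ≤ k × e ≤ 2

bounded? : ∀ k x → Dec (Bounded k x)
bounded? k (c , e) = (c ≤? k) ×-dec (e ≤? 2)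

⟦⟧-bounded : ∀ {k x} m → Bounded k x → ⟦ x ⟧ m ≤ k + 2 * m
⟦⟧-bounded m (c≤k , e≤2) = +-mono-≤ c≤k (*-monoˡ-≤ m e≤2)

-- The offset a translates along C_r; without it, a bounded form is placed at its value, which is below r.
placeᶜ : ∀ k m → ℕ → Affine → Fin (suc (k + 2 * m))
placeᶜ k m a x = (⟦ x ⟧ m + a) mod suc (k + 2 * m)

cycleDist-placeᶜ : ∀ k m a {x y} → Bounded k x → Bounded k y → CycleDistExact k x y →
  cycleDist (suc k + 2 * m) (toℕ (placeᶜ k m a x)) (toℕ (placeᶜ k m a y)) ≡ ⟦ cycleDistᵃ k x y ⟧ m
cycleDist-placeᶜ k m a {x} {y} x-bd y-bd exact
  rewrite toℕ-mod {k + 2 * m} (⟦ x ⟧ m + a) | toℕ-mod {k + 2 * m} (⟦ y ⟧ m + a) =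
  trans (cycleDist-+% a (⟦⟧-bounded m x-bd) (⟦⟧-bounded m y-bd)) (sym (⟦cycleDistᵃ⟧ k m exact))

sucᵃ : Affine → Affine
sucᵃ (c , e) = suc c , e

placeᶜ-sucᵃ : ∀ k m a x → placeᶜ k m a (sucᵃ x) ≡ placeᶜ k m (suc a) x
placeᶜ-sucᵃ k m a (c , e) = cong (_mod suc (k + 2 * m)) (sym (+-suc (c + e * m) a))

placeᶜ-adj : ∀ k m a x → CycAdj (suc (k + 2 * m)) (placeᶜ k m a x) (placeᶜ k m (suc a) x)
placeᶜ-adj k m a x =
  subst (CycAdj _ (placeᶜ k m a x)) (cong (_mod _) (sym (+-suc (⟦ x ⟧ m) a))) (mod-suc-adj (⟦ x ⟧ m + a))

Point : Set
Point = Affine × Affine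

origin : Point
origin = (0 , 0) , (0 , 0)

_≟ᵖ_ : DecidableEquality Point
_≟ᵖ_ = Product.≡-dec (Product.≡-dec _≟_ _≟_) (Product.≡-dec _≟_ _≟_)

open import Data.List.Membership.DecPropositional _≟ᵖ_ using (_∈?_)

_+ᵃ_ : Affine → Affine → Affine
(c , e) +ᵃ (c' , e') = c + c' , e + e'

⟦_⟧² : Affine × Affine → ℕ → ℕ → ℕ
⟦ x , y ⟧² mr ms = ⟦ x ⟧ mr + ⟦ y ⟧ ms

_+²_ : Affine × Affine → Affine × Affine → Affine × Affine
(x , y) +² (x' , y') = x +ᵃ x' , y +ᵃ y'

⟦+²⟧ : ∀ A B mr ms → ⟦ A +² B ⟧² mr ms ≡ ⟦ A ⟧² mr ms + ⟦ B ⟧² mr ms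
⟦+²⟧ ((c , e) , (d , f)) ((c' , e') , (d' , f')) mr ms = regroup c e d f c' e' d' f' mr ms
  where
  regroup : ∀ c e d f c' e' d' f' mr ms →
    (c + c') + (e + e') * mr + ((d + d') + (f + f') * ms) ≡
    (c + e * mr + (d + f * ms)) + (c' + e' * mr + (d' + f' * ms))
  regroup = solve-∀

_<²_ : Affine × Affine → Affine × Affine → Set
((c , e) , (d , f)) <² ((c' , e') , (d' , f')) = c + d < c' + d' × e ≤ e' × f ≤ f'

_<²?_ : ∀ A B → Dec (A <² B)
((c , e) , (d , f)) <²? ((c' , e') , (d' , f')) = (c + d <? c' + d') ×-dec (e ≤? e') ×-dec (f ≤? f')

<²-sound : ∀ A B mr ms → A <² B → ⟦ A ⟧² mr ms < ⟦ B ⟧² mr ms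
<²-sound ((c , e) , (d , f)) ((c' , e') , (d' , f')) mr ms (c+d<c'+d' , e≤e' , f≤f') =
  subst₂ _<_ (sym (split c e d f mr ms)) (sym (split c' e' d' f' mr ms))
    (+-mono-<-≤ c+d<c'+d' (+-mono-≤ (*-monoˡ-≤ mr e≤e') (*-monoˡ-≤ ms f≤f')))
  where
  split : ∀ c e d f mr ms → c + e * mr + (d + f * ms) ≡ (c + d) + (e * mr + f * ms)
  split = solve-∀

module Symbolic (kr ks : ℕ) where

  Boundedᵖ : Point → Set
  Boundedᵖ (x , y) = Bounded kr x × Bounded ks y

  boundedᵖ? : ∀ p → Dec (Boundedᵖ p)
  boundedᵖ? (x , y) = bounded? kr x ×-dec bounded? ks y

  distᵃ : Point → Point → Affine × Affine
  distᵃ (x , y) (x' , y') = cycleDistᵃ kr x x' , cycleDistᵃ ks y y'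

  DistExact : Point → Point → Set
  DistExact (x , y) (x' , y') = CycleDistExact kr x x' × CycleDistExact ks y y'

  distExact? : ∀ p q → Dec (DistExact p q)
  distExact? (x , y) (x' , y') = cycleDistExact? kr x x' ×-dec cycleDistExact? ks y y'

  StrictTriangleᵃ : Point → Point → Point → Set
  StrictTriangleᵃ p q t =
    DistExact p q × DistExact q t × DistExact p t × distᵃ p t <² (distᵃ p q +² distᵃ q t)

  strictTriangleᵃ? : ∀ p q t → Dec (StrictTriangleᵃ p q t)
  strictTriangleᵃ? p q t =
    distExact? p q ×-dec distExact? q t ×-dec distExact? p t ×-dec
    (distᵃ p t <²? (distᵃ p q +² distᵃ q t))

  GeneralPositionᵃ : List Point → Set
  GeneralPositionᵃ Y =
    All (λ p → All (λ q → All (λ t → p ≡ q ⊎ q ≡ t ⊎ p ≡ t ⊎ StrictTriangleᵃ p q t) Y) Y) Y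

  generalPositionᵃ? : ∀ Y → Dec (GeneralPositionᵃ Y)
  generalPositionᵃ? Y = all? (λ p → all? (λ q → all? (λ t →
    (p ≟ᵖ q) ⊎-dec (q ≟ᵖ t) ⊎-dec (p ≟ᵖ t) ⊎-dec strictTriangleᵃ? p q t) Y) Y) Y

  Validᵃ : List Point → Set
  Validᵃ Y = All Boundedᵖ Y × GeneralPositionᵃ Y

  validᵃ? : ∀ Y → Dec (Validᵃ Y)
  validᵃ? Y = all? boundedᵖ? Y ×-dec generalPositionᵃ? Y

  Apartᵃ : Point → Point → Set
  Apartᵃ p q = DistExact p q × ((0 , 0) , (0 , 0)) <² distᵃ p q

  apartᵃ? : ∀ p q → Dec (Apartᵃ p q)
  apartᵃ? p q = distExact? p q ×-dec (((0 , 0) , (0 , 0)) <²? distᵃ p q)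

  MoveOK : List Point → Point → List Point → Set
  MoveOK Y q Y' = Boundedᵖ q × All (Apartᵃ q) Y × Validᵃ Y'

  data Script (σ : Point → Point) : List Point → List Point → Set where
    finished  : ∀ {Y} → Script σ Y Y
    moveRobot : ∀ {Y Z} (i : Fin (length Y)) →
                MoveOK Y (σ (lookup Y i)) (Y [ i ]∷= σ (lookup Y i)) →
                Script σ (Y [ i ]∷= σ (lookup Y i)) Z → Script σ Y Z

  script? : ∀ σ Y Z → List ℕ → Maybe (Script σ Y Z)
  script? σ Y Z [] with List.≡-dec _≟ᵖ_ Y Z
  ... | yes refl = just finished
  ... | no _     = nothing
  script? σ Y Z (i ∷ is) with i <? length Y
  ... | no _      = nothing
  ... | yes i<len = do
    ok   ← dec⇒maybe (boundedᵖ? q ×-dec all? (apartᵃ? q) Y ×-dec validᵃ? Y')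
    rest ← script? σ Y' Z is
    just (moveRobot j ok rest)
    where
    j  = fromℕ< i<len
    q  = σ (lookup Y j)
    Y' = Y [ j ]∷= q

  record Certificate (P : List Point) : Set where
    field
      origin∈P  : origin ∈ P
      valid     : Validᵃ P
      apart     : AllPairs Apartᵃ P
      rightward : Script (map₁ sucᵃ) P (map (map₁ sucᵃ) P)
      upward    : Script (map₂ sucᵃ) P (map (map₂ sucᵃ) P)

  certificate? : ∀ P → (rightOrder upOrder : List ℕ) → Maybe (Certificate P)
  certificate? P rightOrder upOrder = do
    o ← dec⇒maybe (origin ∈? P)
    v ← dec⇒maybe (validᵃ? P)
    a ← dec⇒maybe (allPairs? apartᵃ? P)
    r ← script? (map₁ sucᵃ) P (map (map₁ sucᵃ) P) rightOrder
    u ← script? (map₂ sucᵃ) P (map (map₂ sucᵃ) P) upOrder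
    just (record { origin∈P = o ; valid = v ; apart = a ; rightward = r ; upward = u })

lookup-map : ∀ {A B : Set} (f : A → B) (xs : List A) i →
             lookup (map f xs) (cast (sym (length-map f xs)) i) ≡ f (lookup xs i)
lookup-map f (x ∷ xs) Fin.zero    = refl
lookup-map f (x ∷ xs) (Fin.suc i) = lookup-map f xs i

module Placement (kr ks mr ms : ℕ) where
  open Symbolic kr ks

  Torus : Graph
  Torus = Cycle (suc kr + 2 * mr) □ Cycle (suc ks + 2 * ms)

  open WalkMetric (cycleMetric (kr + 2 * mr) □ᵐ cycleMetric (ks + 2 * ms))

  place : ℕ → ℕ → Point → V Torus
  place a b (x , y) = placeᶜ kr mr a x , placeᶜ ks ms b y

  conf : ℕ → ℕ → List Point → List (V Torus)
  conf a b = map (place a b)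

  dist-place : ∀ a b {p q} → Boundedᵖ p → Boundedᵖ q → DistExact p q →
               dist (place a b p) (place a b q) ≡ ⟦ distᵃ p q ⟧² mr ms
  dist-place a b (x-bd , y-bd) (x'-bd , y'-bd) (x-exact , y-exact) =
    cong₂ _+_ (cycleDist-placeᶜ kr mr a x-bd x'-bd x-exact) (cycleDist-placeᶜ ks ms b y-bd y'-bd y-exact)

  triangle-place : ∀ a b {p q t} → Boundedᵖ p → Boundedᵖ q → Boundedᵖ t →
    p ≡ q ⊎ q ≡ t ⊎ p ≡ t ⊎ StrictTriangleᵃ p q t →
    place a b p ≢ place a b q → place a b q ≢ place a b t → place a b p ≢ place a b t →
    dist (place a b p) (place a b t) < dist (place a b p) (place a b q) + dist (place a b q) (place a b t)
  triangle-place a b _ _ _ (inj₁ refl)               p≢q _ _ = contradiction refl p≢q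
  triangle-place a b _ _ _ (inj₂ (inj₁ refl))        _ q≢t _ = contradiction refl q≢t
  triangle-place a b _ _ _ (inj₂ (inj₂ (inj₁ refl))) _ _ p≢t = contradiction refl p≢t
  triangle-place a b {p} {q} {t} p-bd q-bd t-bd (inj₂ (inj₂ (inj₂ (pq , qt , pt , shorter)))) _ _ _ =
    begin-strict
      dist (place a b p) (place a b t)         ≡⟨ dist-place a b p-bd t-bd pt ⟩
      ⟦ distᵃ p t ⟧² mr ms                     <⟨ <²-sound (distᵃ p t) detour mr ms shorter ⟩
      ⟦ detour ⟧² mr ms                        ≡⟨ ⟦+²⟧ (distᵃ p q) (distᵃ q t) mr ms ⟩
      ⟦ distᵃ p q ⟧² mr ms + ⟦ distᵃ q t ⟧² mr ms
        ≡⟨ cong₂ _+_ (dist-place a b p-bd q-bd pq) (dist-place a b q-bd t-bd qt) ⟨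
      dist (place a b p) (place a b q) + dist (place a b q) (place a b t) ∎
    where
    open ≤-Reasoning
    detour = distᵃ p q +² distᵃ q t

  strictTriangles-place : ∀ a b {Y} → Validᵃ Y → StrictTriangles (conf a b Y)
  strictTriangles-place a b (bounded , gp) = map-strictTriangles (place a b) λ p∈ q∈ t∈ →
    triangle-place a b (All.lookup bounded p∈) (All.lookup bounded q∈) (All.lookup bounded t∈)
      (All.lookup (All.lookup (All.lookup gp p∈) q∈) t∈)

  apart⇒≢ : ∀ a b {p q} → Boundedᵖ p → Boundedᵖ q → Apartᵃ p q → place a b p ≢ place a b q
  apart⇒≢ a b {p} {q} p-bd q-bd (exact , positive) =
    dist>0⇒≢ (subst (0 <_) (sym (dist-place a b p-bd q-bd exact))
                        (<²-sound ((0 , 0) , (0 , 0)) (distᵃ p q) mr ms positive))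

  apart⇒∉ : ∀ a b {q Y} → Boundedᵖ q → All Boundedᵖ Y → All (Apartᵃ q) Y → place a b q ∉ conf a b Y
  apart⇒∉ a b q-bd Y-bd apart q∈ with ∈-map⁻ (place a b) q∈
  ... | p , p∈ , eq = apart⇒≢ a b q-bd (All.lookup Y-bd p∈) (All.lookup apart p∈) eq

  unique-conf : ∀ a b {Y} → All Boundedᵖ Y → AllPairs Apartᵃ Y → Unique (conf a b Y)
  unique-conf a b []             []             = []
  unique-conf a b (p-bd ∷ Y-bd) (apart ∷ Y-apart) =
    ¬Any⇒All¬ _ (apart⇒∉ a b p-bd Y-bd apart) ∷ unique-conf a b Y-bd Y-apart

  module _ {σ : Point → Point} {a b a' b' : ℕ}
           (place-σ : ∀ p → place a b (σ p) ≡ place a' b' p)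
           (adjacent : ∀ p → Adj Torus (place a b p) (place a' b' p)) where

    legal-move : ∀ {Y} (i : Fin (length Y)) → All Boundedᵖ Y →
                 MoveOK Y (σ (lookup Y i)) (Y [ i ]∷= σ (lookup Y i)) →
                 Legal Torus (conf a b Y) (conf a b (Y [ i ]∷= σ (lookup Y i)))
    legal-move {Y} i Y-bd (q-bd , apart , valid') =
      cast (sym (length-map (place a b) Y)) i , place a b q ,
      subst₂ (Adj Torus) (sym (lookup-map (place a b) Y i)) (sym (place-σ p)) (adjacent p) ,
      apart⇒∉ a b q-bd Y-bd apart ,
      map-∷= Y i q (place a b) ,
      strictTriangles⇒generalPosition (strictTriangles-place a b valid')
      where
      p = lookup Y i
      q = σ p

    script⇒block : ∀ {Y Z} → All Boundedᵖ Y → Script σ Y Z → Block (conf a b Y) (conf a b Z)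
    script⇒block Y-bd finished = [] , here refl , id
    script⇒block Y-bd (moveRobot i ok@(_ , _ , Y'-bd , _) rest) with script⇒block Y'-bd rest
    ... | Ls , Z∈ , run = _ ∷ Ls , there Z∈ , λ tail → move (legal-move i Y-bd ok) (run tail)

    conf-σ : ∀ P → conf a b (map σ P) ≡ conf a' b' P
    conf-σ P = trans (sym (map-∘ P)) (map-cong place-σ P)

  place-right : ∀ a b p → place a b (map₁ sucᵃ p) ≡ place (suc a) b p
  place-right a b (x , y) = cong (_, _) (placeᶜ-sucᵃ kr mr a x)

  place-up : ∀ a b p → place a b (map₂ sucᵃ p) ≡ place a (suc b) p
  place-up a b (x , y) = cong (_ ,_) (placeᶜ-sucᵃ ks ms b y)

  adjacent-right : ∀ a b p → Adj Torus (place a b p) (place (suc a) b p)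
  adjacent-right a b (x , y) = inj₁ (placeᶜ-adj kr mr a x , refl)

  adjacent-up : ∀ a b p → Adj Torus (place a b p) (place a (suc b) p)
  adjacent-up a b (x , y) = inj₂ (refl , placeᶜ-adj ks ms b y)

  place-origin : ∀ x y → place (toℕ x + toℕ y * suc (kr + 2 * mr)) (toℕ y) origin ≡ (x , y)
  place-origin x y =
    cong₂ _,_ ([x+kn]mod≡x x (toℕ y)) (subst (λ z → z mod _ ≡ y) (+-identityʳ (toℕ y)) ([x+kn]mod≡x y 0))

  certificate⇒mobile : ∀ {P} → Certificate P → MobAtLeast Torus (length P)
  certificate⇒mobile {P} cert =
    conf 0 0 P ,
    (unique-conf 0 0 (proj₁ valid) apart ,
     strictTriangles⇒generalPosition (strictTriangles-place 0 0 valid) ,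
     tour 0 0 R J , tour-moves 0 0 R J , covered) ,
    ≤-reflexive (sym (length-map (place 0 0) P))
    where
    open Certificate cert
    R = suc (kr + 2 * mr)
    J = ks + 2 * ms

    right : ∀ a b → Block (conf a b P) (conf (suc a) b P)
    right a b = subst (Block (conf a b P)) (conf-σ (place-right a b) (adjacent-right a b) P)
                      (script⇒block (place-right a b) (adjacent-right a b) (proj₁ valid) rightward)

    up : ∀ a b → Block (conf a b P) (conf a (suc b) P)
    up a b = subst (Block (conf a b P)) (conf-σ (place-up a b) (adjacent-up a b) P)
                   (script⇒block (place-up a b) (adjacent-up a b) (proj₁ valid) upward)

    open GridTour (λ a b → conf a b P) right up R

    covered : ∀ v → Any (v ∈_) (conf 0 0 P ∷ tour 0 0 R J)
    covered (x , y) =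
      lose (tour-visits (toℕ x) (toℕ y) J (<⇒≤ (toℕ<n x)) (≤-pred (toℕ<n y)))
           (subst (_∈ conf a b P) (place-origin x y) (∈-map⁺ (place a b) origin∈P))
      where
      a = toℕ x + toℕ y * R
      b = toℕ y

even⊎odd : ∀ n → ∃[ m ] (n ≡ 2 * m ⊎ n ≡ suc (2 * m))
even⊎odd n with n % 2 | m≡m%n+[m/n]*n n 2 | m%n<n n 2
... | 0           | n≡ | _ = n / 2 , inj₁ (trans n≡ (*-comm (n / 2) 2))
... | 1           | n≡ | _ = n / 2 , inj₂ (trans n≡ (cong suc (*-comm (n / 2) 2)))
... | suc (suc _) | _  | s≤s (s≤s ())

≥⇒parity-offset : ∀ {b n} → b ≤ n → ∃[ m ] (n ≡ b + 2 * m ⊎ n ≡ suc b + 2 * m)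
≥⇒parity-offset {n = n} z≤n = even⊎odd n
≥⇒parity-offset (s≤s b≤n) with ≥⇒parity-offset b≤n
... | m , inj₁ eq = m , inj₁ (cong suc eq)
... | m , inj₂ eq = m , inj₂ (cong suc eq)

≡9⊎>10⇒9+2m⊎12+2m : ∀ {r} → r ≡ 9 ⊎ r > 10 → ∃[ m ] (r ≡ 9 + 2 * m ⊎ r ≡ 12 + 2 * m)
≡9⊎>10⇒9+2m⊎12+2m (inj₁ refl) = 0 , inj₁ refl
≡9⊎>10⇒9+2m⊎12+2m (inj₂ r>10) with ≥⇒parity-offset r>10
... | m , inj₁ eq = suc m , inj₁ (trans eq (cong (9 +_) (sym (*-suc 2 m))))
... | m , inj₂ eq = m , inj₂ eq

-- For r = suc k + 2m: fromEnd k j is the vertex r − j of C_r, and middle k is ⌊(r − 4)/2⌋.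
fromEnd : ℕ → ℕ → Affine
fromEnd k j = suc k ∸ j , 2

middle : ℕ → Affine
middle k = ⌊ suc k ∸ 4 /2⌋ , 1

pentagon : ℕ → ℕ → List Point
pentagon kr ks =
  origin ∷ (fromEnd kr 3 , fromEnd ks 3) ∷ (fromEnd kr 3 , (1 , 0)) ∷
  (fromEnd kr 2 , middle ks) ∷ (middle kr , middle ks) ∷ []

pentagon-certificate? : ∀ kr ks → Maybe (Symbolic.Certificate kr ks (pentagon kr ks))
pentagon-certificate? kr ks =
  Symbolic.certificate? kr ks (pentagon kr ks) (0 ∷ 3 ∷ 4 ∷ 1 ∷ 2 ∷ []) (2 ∷ 0 ∷ 3 ∷ 4 ∷ 1 ∷ [])

pentagon-9-10 : Symbolic.Certificate 8 9 (pentagon 8 9)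
pentagon-9-10 = from-just (pentagon-certificate? 8 9)

pentagon-9-11 : Symbolic.Certificate 8 10 (pentagon 8 10)
pentagon-9-11 = from-just (pentagon-certificate? 8 10)

pentagon-12-10 : Symbolic.Certificate 11 9 (pentagon 11 9)
pentagon-12-10 = from-just (pentagon-certificate? 11 9)

pentagon-12-11 : Symbolic.Certificate 11 10 (pentagon 11 10)
pentagon-12-11 = from-just (pentagon-certificate? 11 10)

corollary3p8 : ∀ (r s : ℕ) → (r ≡ 9 ⊎ r > 10) → s ≥ 10 →
    MobAtLeast (Cycle r □ Cycle s) 5
corollary3p8 r s r≡9⊎r>10 s≥10 with ≡9⊎>10⇒9+2m⊎12+2m r≡9⊎r>10 | ≥⇒parity-offset s≥10
... | mr , inj₁ refl | ms , inj₁ refl = Placement.certificate⇒mobile 8 9 mr ms pentagon-9-10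
... | mr , inj₁ refl | ms , inj₂ refl = Placement.certificate⇒mobile 8 10 mr ms pentagon-9-11
... | mr , inj₂ refl | ms , inj₁ refl = Placement.certificate⇒mobile 11 9 mr ms pentagon-12-10
... | mr , inj₂ refl | ms , inj₂ refl = Placement.certificate⇒mobile 11 10 mr ms pentagon-12-11
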